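{- Let $G$ be a graph whose connected components are $G_1,\ldots,G_t$. Then $K_{IHN}(G)\ge\prod_{i=1}^tK_{IHN}(G_i)$.
   Context: To a simple undirected graph $G$ with vertex set $\{0,\ldots,n-1\}$ and edge set $E$ associate $p_G(x)=\sum_{ab\in E}x_ax_b$. $K_{IHN}(G)$ is the number of transforms $U\in\{I,H,N\}^n$ (all $3^n$ $n$-fold tensor products of matrices from $\{I,H,N\}$, where $I$ is the $2\times2$ identity, $H=\frac1{\sqrt2}\begin{pmatrix}1&1\\1&-1\end{pmatrix}$, $N=\frac1{\sqrt2}\begin{pmatrix}1&i\\1&-i\end{pmatrix}$, $i^2=-1$) such that all entries of $U(-1)^{p_G}$ have absolute value $1$; $(-1)^{p_G}\in\mathbb C^{2^n}$ has entries $(-1)^{p_G(x)}$. For a component the count is over its own vertex set. -}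

module Defs where

open import Data.Nat using (ℕ; zero; suc; _^_; _<ᵇ_)
open import Data.Integer as ℤ using (ℤ; +_)
open import Data.Bool using (Bool; true; false; _∧_; _xor_; if_then_else_)
open import Data.Fin as Fin using (Fin)
open import Data.Fin.Properties using (_≟_)
open import Data.Vec as Vec using (Vec; []; _∷_)
open import Data.List as List using (List; []; _∷_; length; filter; allFin; concatMap; map; foldr)
open import Data.Product using (_×_; _,_)
open import Relation.Binary.PropositionalEquality using (_≡_)
open import Relation.Nullary.Decidable using (⌊_⌋)

record Graph (n : ℕ) : Set where
  field
    adj    : Fin n → Fin n → Bool
    sym    : ∀ a b → adj a b ≡ adj b a
    irrefl : ∀ a → adj a a ≡ false
open Graph public

data Reachable {n : ℕ} (G : Graph n) : Fin n → Fin n → Set where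
  here : ∀ {u} → Reachable G u u
  step : ∀ {u v w} → adj G u v ≡ true → Reachable G v w → Reachable G u w

induced : ∀ {n} (G : Graph n) (l : List (Fin n)) → Graph (length l)
induced G l = record
  { adj    = λ i j → adj G (List.lookup l i) (List.lookup l j)
  ; sym    = λ i j → sym G (List.lookup l i) (List.lookup l j)
  ; irrefl = λ i → irrefl G (List.lookup l i)
  }

-- p_G(x) = Σ_{ab ∈ E} x_a x_b  (mod 2, as a Bool parity)

pG : ∀ {n} → Graph n → Vec Bool n → Bool
pG {n} G x =
  foldr _xor_ false
    (concatMap (λ a → map (λ b →
        (Fin.toℕ a <ᵇ Fin.toℕ b) ∧ adj G a b ∧ Vec.lookup x a ∧ Vec.lookup x b)
      (allFin n)) (allFin n))

infix 5 _+i_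
record GI : Set where
  constructor _+i_
  field re im : ℤ
open GI public

gzero gone : GI
gzero = + 0 +i + 0
gone  = + 1 +i + 0

_g+_ _g*_ : GI → GI → GI
(a +i b) g+ (c +i d) = (a ℤ.+ c) +i (b ℤ.+ d)
(a +i b) g* (c +i d) = (a ℤ.* c ℤ.- b ℤ.* d) +i (a ℤ.* d ℤ.+ b ℤ.* c)

gneg : GI → GI
gneg (a +i b) = ℤ.- a +i ℤ.- b

normSq : GI → ℤ
normSq (a +i b) = a ℤ.* a ℤ.+ b ℤ.* b

-- The gates I, H, N.  H and N carry the scalar 1/√2; we store the
-- matrices √2·H = [[1,1],[1,-1]] and √2·N = [[1,i],[1,-i]] and account
-- for the scalars separately.

data Gate : Set where
  I H N : Gate

-- scaled entry M[row][col]; false = 0, true = 1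
entry : Gate → Bool → Bool → GI
entry I false false = gone
entry I true  true  = gone
entry I _     _     = gzero
entry H true  true  = gneg gone
entry H _     _     = gone
entry N _     false = gone
entry N false true  = + 0 +i + 1
entry N true  true  = + 0 +i ℤ.-[1+ 0 ]

-- number of factors H or N: U = (1/√2)^k · (scaled tensor product)
scaleExp : ∀ {n} → Vec Gate n → ℕ
scaleExp [] = 0
scaleExp (I ∷ u) = scaleExp u
scaleExp (H ∷ u) = suc (scaleExp u)
scaleExp (N ∷ u) = suc (scaleExp u)

allVecs : ∀ {A : Set} → List A → (n : ℕ) → List (Vec A n)
allVecs xs zero    = [] ∷ []
allVecs xs (suc n) = concatMap (λ a → map (a ∷_) (allVecs xs n)) xs

allBits : (n : ℕ) → List (Vec Bool n)
allBits = allVecs (false ∷ true ∷ [])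

allTransforms : (n : ℕ) → List (Vec Gate n)
allTransforms = allVecs (I ∷ H ∷ N ∷ [])

tensorEntry : ∀ {n} → Vec Gate n → Vec Bool n → Vec Bool n → GI
tensorEntry []       []       []       = gone
tensorEntry (g ∷ u) (y ∷ ys) (x ∷ xs) = entry g y x g* tensorEntry u ys xs

sign : Bool → GI
sign false = gone
sign true  = gneg gone

-- (√2)^k · (U (-1)^{p_G})_y
scaledOut : ∀ {n} → Graph n → Vec Gate n → Vec Bool n → GI
scaledOut {n} G u y =
  foldr _g+_ gzero (map (λ x → tensorEntry u y x g* sign (pG G x)) (allBits n))

allB : ∀ {A : Set} → (A → Bool) → List A → Bool
allB f = foldr (λ a r → f a ∧ r) true

-- all entries of U(-1)^{p_G} have absolute value 1, i.e.
-- |(√2)^k · entry|^2 = 2^k for every output index y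
flatB : ∀ {n} → Graph n → Vec Gate n → Bool
flatB {n} G u =
  allB (λ y → ⌊ normSq (scaledOut G u y) ℤ.≟ + (2 ^ scaleExp u) ⌋) (allBits n)

K-IHN : ∀ {n} → Graph n → ℕ
K-IHN {n} G = length (List.filter (λ u → flatB G u Data.Bool.≟ true) (allTransforms n))
  where import Data.Bool

-- Components given by a labelling comp : Fin n → Fin t

members : ∀ {n t} → (Fin n → Fin t) → Fin t → List (Fin n)
members {n} comp i = filter (λ v → comp v ≟ i) (allFin n)

component : ∀ {n t} → Graph n → (comp : Fin n → Fin t) → (i : Fin t) → Graph (length (members comp i))
component G comp i = induced G (members comp i)

module Submission where

-- If no edge joins the vertex sets of G₁ and G₂, then
-- p_G(x₁, x₂) = p_G₁(x₁) + p_G₂(x₂) (mod 2), so (-1)^{p_G} = (-1)^{p_G₁} ⊗ (-1)^{p_G₂}.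
-- For U = U₁ ⊗ U₂ the output U(-1)^{p_G} is then the tensor product of the two
-- outputs, whose entries are products of entries; hence U is flat as soon as
-- U₁ and U₂ are.  Distinct pairs (U₁, U₂) give distinct U, so
-- K(G) ≥ K(G₁) · K(G₂), and induction over the components gives the product bound.

open import Defs
open import Data.Nat using (ℕ; zero; suc; _≥_; _≤_; _+_; _*_; _^_; _<ᵇ_; z≤n)
import Data.Nat.Properties as ℕₚ
open import Data.Integer as ℤ using (ℤ; +_)
import Data.Integer.Properties as ℤₚ
open import Data.Integer.Tactic.RingSolver using (solve-∀)
open import Data.Bool as Bool using (Bool; true; false; _∧_; _xor_; if_then_else_)
import Data.Bool.Properties as Boolₚ
open import Data.Fin using (Fin; zero; suc; toℕ; cast)
open import Data.Fin.Properties using (_≟_; cast-is-id; cast-involutive)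
open import Data.Vec using (Vec; []; _∷_)
import Data.Vec as Vec
open import Data.List using (List; []; _∷_; _++_; length; map; allFin; filter; concat; foldr; lookup; tabulate)
import Data.List.Properties as Listₚ
open import Data.List.Relation.Unary.All as All using (All; []; _∷_)
open import Data.List.Relation.Unary.All.Properties using (all-filter; All¬⇒¬Any)
open import Data.List.Relation.Unary.Any as Any using (here; there)
open import Data.List.Relation.Unary.AllPairs using ([]; _∷_)
open import Data.List.Relation.Unary.Unique.Propositional using (Unique)
open import Data.List.Relation.Unary.Unique.Propositional.Properties using (allFin⁺)
open import Data.List.Relation.Ternary.Interleaving.Propositional using (Interleaving; []; consˡ; consʳ)
open import Data.List.Membership.Propositional using (_∈_; _∉_)
open import Data.List.Membership.Propositional.Properties using (∈-allFin; ∈-map⁺; ∈-concatMap⁺)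
open import Data.Nat.ListAction using (product; sum)
open import Data.Product using (∃)
open import Data.Sum using (_⊎_; inj₁; inj₂; [_,_])
open import Data.Empty using (⊥-elim)
open import Function using (_∘_; id)
open import Function.Bundles using (_⇔_; mk⇔; Equivalence)
open import Relation.Nullary using (¬_; yes; no)
open import Relation.Nullary.Decidable using (⌊_⌋; toWitness; fromWitness)
open import Relation.Unary using (Decidable)
open import Relation.Binary.PropositionalEquality using (_≡_; refl; cong; cong₂; subst; subst₂; module ≡-Reasoning)
import Relation.Binary.PropositionalEquality as ≡
open import Algebra.Bundles using (CommutativeRing)
open import Algebra.Properties.CommutativeSemigroup
  (CommutativeRing.+-commutativeSemigroup Boolₚ.xor-∧-commutativeRing) using (x∙yz≈y∙xz)

g+-assoc : ∀ x y z → (x g+ y) g+ z ≡ x g+ (y g+ z)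
g+-assoc (a +i b) (c +i d) (e +i f) = cong₂ _+i_ (ℤₚ.+-assoc a c e) (ℤₚ.+-assoc b d f)

g+-identityˡ : ∀ x → gzero g+ x ≡ x
g+-identityˡ (a +i b) = cong₂ _+i_ (ℤₚ.+-identityˡ a) (ℤₚ.+-identityˡ b)

g*-assoc : ∀ x y z → (x g* y) g* z ≡ x g* (y g* z)
g*-assoc (a +i b) (c +i d) (e +i f) = cong₂ _+i_ (re-assoc a b c d e f) (im-assoc a b c d e f)
  where
  re-assoc : ∀ a b c d e f → (a ℤ.* c ℤ.- b ℤ.* d) ℤ.* e ℤ.- (a ℤ.* d ℤ.+ b ℤ.* c) ℤ.* f
                           ≡ a ℤ.* (c ℤ.* e ℤ.- d ℤ.* f) ℤ.- b ℤ.* (c ℤ.* f ℤ.+ d ℤ.* e)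
  re-assoc = solve-∀
  im-assoc : ∀ a b c d e f → (a ℤ.* c ℤ.- b ℤ.* d) ℤ.* f ℤ.+ (a ℤ.* d ℤ.+ b ℤ.* c) ℤ.* e
                           ≡ a ℤ.* (c ℤ.* f ℤ.+ d ℤ.* e) ℤ.+ b ℤ.* (c ℤ.* e ℤ.- d ℤ.* f)
  im-assoc = solve-∀

g*-comm : ∀ x y → x g* y ≡ y g* x
g*-comm (a +i b) (c +i d) = cong₂ _+i_ (re-comm a b c d) (im-comm a b c d)
  where
  re-comm : ∀ a b c d → a ℤ.* c ℤ.- b ℤ.* d ≡ c ℤ.* a ℤ.- d ℤ.* b
  re-comm = solve-∀
  im-comm : ∀ a b c d → a ℤ.* d ℤ.+ b ℤ.* c ≡ c ℤ.* b ℤ.+ d ℤ.* a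
  im-comm = solve-∀

g*-distribˡ : ∀ x y z → x g* (y g+ z) ≡ (x g* y) g+ (x g* z)
g*-distribˡ (a +i b) (c +i d) (e +i f) = cong₂ _+i_ (re-distrib a b c d e f) (im-distrib a b c d e f)
  where
  re-distrib : ∀ a b c d e f → a ℤ.* (c ℤ.+ e) ℤ.- b ℤ.* (d ℤ.+ f)
                             ≡ (a ℤ.* c ℤ.- b ℤ.* d) ℤ.+ (a ℤ.* e ℤ.- b ℤ.* f)
  re-distrib = solve-∀
  im-distrib : ∀ a b c d e f → a ℤ.* (d ℤ.+ f) ℤ.+ b ℤ.* (c ℤ.+ e)
                             ≡ (a ℤ.* d ℤ.+ b ℤ.* c) ℤ.+ (a ℤ.* f ℤ.+ b ℤ.* e)
  im-distrib = solve-∀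

g*-distribʳ : ∀ x y z → (y g+ z) g* x ≡ (y g* x) g+ (z g* x)
g*-distribʳ x y z = ≡.trans (g*-comm (y g+ z) x)
  (≡.trans (g*-distribˡ x y z) (cong₂ _g+_ (g*-comm x y) (g*-comm x z)))

g*-zeroʳ : ∀ x → x g* gzero ≡ gzero
g*-zeroʳ (a +i b) = cong₂ _+i_ (re-zero a b) (im-zero a b)
  where
  re-zero : ∀ a b → a ℤ.* + 0 ℤ.- b ℤ.* + 0 ≡ + 0
  re-zero = solve-∀
  im-zero : ∀ a b → a ℤ.* + 0 ℤ.+ b ℤ.* + 0 ≡ + 0
  im-zero = solve-∀

normSq-g* : ∀ x y → normSq (x g* y) ≡ normSq x ℤ.* normSq y
normSq-g* (a +i b) (c +i d) = brahmagupta a b c d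
  where
  brahmagupta : ∀ a b c d →
    (a ℤ.* c ℤ.- b ℤ.* d) ℤ.* (a ℤ.* c ℤ.- b ℤ.* d) ℤ.+ (a ℤ.* d ℤ.+ b ℤ.* c) ℤ.* (a ℤ.* d ℤ.+ b ℤ.* c)
      ≡ (a ℤ.* a ℤ.+ b ℤ.* b) ℤ.* (c ℤ.* c ℤ.+ d ℤ.* d)
  brahmagupta = solve-∀

g*-factorʳ : ∀ a b c d e → (a g* (b g* e)) g+ (c g* (d g* e)) ≡ ((a g* b) g+ (c g* d)) g* e
g*-factorʳ a b c d e = ≡.trans
  (cong₂ _g+_ (≡.sym (g*-assoc a b e)) (≡.sym (g*-assoc c d e)))
  (≡.sym (g*-distribʳ e (a g* b) (c g* d)))

g*-factorˡ : ∀ a b c d e → (a g* (e g* b)) g+ (c g* (e g* d)) ≡ e g* ((a g* b) g+ (c g* d))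
g*-factorˡ a b c d e = ≡.trans (cong₂ _g+_ (swap a b) (swap c d)) (≡.sym (g*-distribˡ e (a g* b) (c g* d)))
  where
  swap : ∀ a b → a g* (e g* b) ≡ e g* (a g* b)
  swap a b = ≡.trans (≡.sym (g*-assoc a e b)) (≡.trans (cong (_g* b) (g*-comm a e)) (g*-assoc e a b))

gsum : List GI → GI
gsum = foldr _g+_ gzero

gsum-++ : ∀ xs ys → gsum (xs ++ ys) ≡ gsum xs g+ gsum ys
gsum-++ []       ys = ≡.sym (g+-identityˡ (gsum ys))
gsum-++ (x ∷ xs) ys = ≡.trans (cong (x g+_) (gsum-++ xs ys)) (≡.sym (g+-assoc x (gsum xs) (gsum ys)))

gsum-map-g*ˡ : ∀ c xs → gsum (map (c g*_) xs) ≡ c g* gsum xs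
gsum-map-g*ˡ c []       = ≡.sym (g*-zeroʳ c)
gsum-map-g*ˡ c (x ∷ xs) = ≡.trans (cong ((c g* x) g+_) (gsum-map-g*ˡ c xs)) (≡.sym (g*-distribˡ c x (gsum xs)))

sumBits : ∀ {m} → (Vec Bool m → GI) → GI
sumBits {m} F = gsum (map F (allBits m))

sumBits-cong : ∀ {m} {F F′ : Vec Bool m → GI} → (∀ x → F x ≡ F′ x) → sumBits F ≡ sumBits F′
sumBits-cong {m} eq = cong gsum (Listₚ.map-cong eq (allBits m))

sumBits-g*ˡ : ∀ {m} c (F : Vec Bool m → GI) → sumBits (λ x → c g* F x) ≡ c g* sumBits F
sumBits-g*ˡ {m} c F = ≡.trans (cong gsum (Listₚ.map-∘ (allBits m))) (gsum-map-g*ˡ c (map F (allBits m)))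

sumBits-suc : ∀ {m} (F : Vec Bool (suc m) → GI) →
  sumBits F ≡ sumBits (λ x → F (false ∷ x)) g+ sumBits (λ x → F (true ∷ x))
sumBits-suc {m} F = begin
  gsum (map F (B₀ ++ (B₁ ++ [])))           ≡⟨ cong (gsum ∘ map F) (cong (B₀ ++_) (Listₚ.++-identityʳ B₁)) ⟩
  gsum (map F (B₀ ++ B₁))                   ≡⟨ cong gsum (Listₚ.map-++ F B₀ B₁) ⟩
  gsum (map F B₀ ++ map F B₁)               ≡⟨ gsum-++ (map F B₀) (map F B₁) ⟩
  gsum (map F B₀) g+ gsum (map F B₁)        ≡⟨ cong₂ _g+_ (cong gsum (≡.sym (Listₚ.map-∘ (allBits m))))
                                                          (cong gsum (≡.sym (Listₚ.map-∘ (allBits m)))) ⟩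
  sumBits (λ x → F (false ∷ x)) g+ sumBits (λ x → F (true ∷ x)) ∎
  where
  open ≡-Reasoning
  B₀ B₁ : List (Vec Bool (suc m))
  B₀ = map (false ∷_) (allBits m)
  B₁ = map (true ∷_) (allBits m)

-- (√2)^{scaleExp u} times the y-th entry of u (-1)^f; scaledOut G is amplitude (pG G).
amplitude : ∀ {m} → Vec Gate m → Vec Bool m → (Vec Bool m → Bool) → GI
amplitude u y f = sumBits (λ x → tensorEntry u y x g* sign (f x))

amplitude-cong : ∀ {m} (u : Vec Gate m) y {f f′ : Vec Bool m → Bool} →
  (∀ x → f x ≡ f′ x) → amplitude u y f ≡ amplitude u y f′
amplitude-cong u y eq = sumBits-cong (λ x → cong (λ b → tensorEntry u y x g* sign b) (eq x))

amplitude-∷ : ∀ {m} g (u : Vec Gate m) y₀ y f →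
  amplitude (g ∷ u) (y₀ ∷ y) f
    ≡ (entry g y₀ false g* amplitude u y (λ x → f (false ∷ x)))
        g+ (entry g y₀ true g* amplitude u y (λ x → f (true ∷ x)))
amplitude-∷ g u y₀ y f =
  ≡.trans (sumBits-suc (λ x → tensorEntry (g ∷ u) (y₀ ∷ y) x g* sign (f x)))
          (cong₂ _g+_ (column false) (column true))
  where
  column : ∀ b → sumBits (λ x → (entry g y₀ b g* tensorEntry u y x) g* sign (f (b ∷ x)))
               ≡ entry g y₀ b g* amplitude u y (λ x → f (b ∷ x))
  column b = ≡.trans
    (sumBits-cong (λ x → g*-assoc (entry g y₀ b) (tensorEntry u y x) (sign (f (b ∷ x)))))
    (sumBits-g*ˡ (entry g y₀ b) (λ x → tensorEntry u y x g* sign (f (b ∷ x))))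

module _ {X A : Set} where

  split₁ : ∀ {l₁ l₂ l : List X} → Interleaving l₁ l₂ l → Vec A (length l) → Vec A (length l₁)
  split₁ []        []       = []
  split₁ (consˡ p) (a ∷ as) = a ∷ split₁ p as
  split₁ (consʳ p) (a ∷ as) = split₁ p as

  split₂ : ∀ {l₁ l₂ l : List X} → Interleaving l₁ l₂ l → Vec A (length l) → Vec A (length l₂)
  split₂ []        []       = []
  split₂ (consˡ p) (a ∷ as) = split₂ p as
  split₂ (consʳ p) (a ∷ as) = a ∷ split₂ p as

  merge : ∀ {l₁ l₂ l : List X} → Interleaving l₁ l₂ l →
          Vec A (length l₁) → Vec A (length l₂) → Vec A (length l)
  merge []        []       []       = []
  merge (consˡ p) (a ∷ as) bs       = a ∷ merge p as bs
  merge (consʳ p) as       (b ∷ bs) = b ∷ merge p as bs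

  split₁-merge : ∀ {l₁ l₂ l : List X} (p : Interleaving l₁ l₂ l) as bs → split₁ p (merge p as bs) ≡ as
  split₁-merge []        []       []       = refl
  split₁-merge (consˡ p) (a ∷ as) bs       = cong (a ∷_) (split₁-merge p as bs)
  split₁-merge (consʳ p) as       (b ∷ bs) = split₁-merge p as bs

  split₂-merge : ∀ {l₁ l₂ l : List X} (p : Interleaving l₁ l₂ l) as bs → split₂ p (merge p as bs) ≡ bs
  split₂-merge []        []       []       = refl
  split₂-merge (consˡ p) (a ∷ as) bs       = split₂-merge p as bs
  split₂-merge (consʳ p) as       (b ∷ bs) = cong (b ∷_) (split₂-merge p as bs)

scaleExp-merge : ∀ {X : Set} {l₁ l₂ l : List X} (p : Interleaving l₁ l₂ l) u₁ u₂ →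
  scaleExp (merge p u₁ u₂) ≡ scaleExp u₁ + scaleExp u₂
scaleExp-merge []        []       []       = refl
scaleExp-merge (consˡ p) (I ∷ u₁) u₂       = scaleExp-merge p u₁ u₂
scaleExp-merge (consˡ p) (H ∷ u₁) u₂       = cong suc (scaleExp-merge p u₁ u₂)
scaleExp-merge (consˡ p) (N ∷ u₁) u₂       = cong suc (scaleExp-merge p u₁ u₂)
scaleExp-merge (consʳ p) u₁       (I ∷ u₂) = scaleExp-merge p u₁ u₂
scaleExp-merge (consʳ p) u₁       (H ∷ u₂) =
  ≡.trans (cong suc (scaleExp-merge p u₁ u₂)) (≡.sym (ℕₚ.+-suc (scaleExp u₁) (scaleExp u₂)))
scaleExp-merge (consʳ p) u₁       (N ∷ u₂) =
  ≡.trans (cong suc (scaleExp-merge p u₁ u₂)) (≡.sym (ℕₚ.+-suc (scaleExp u₁) (scaleExp u₂)))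

amplitude-interleave : ∀ {X : Set} {l₁ l₂ l : List X} (p : Interleaving l₁ l₂ l) u y h₁ h₂ →
  amplitude u y (λ x → h₁ (split₁ p x) xor h₂ (split₂ p x))
    ≡ amplitude (split₁ p u) (split₁ p y) h₁ g* amplitude (split₂ p u) (split₂ p y) h₂
amplitude-interleave [] [] [] h₁ h₂ with h₁ [] | h₂ []
... | false | false = refl
... | false | true  = refl
... | true  | false = refl
... | true  | true  = refl
amplitude-interleave {l₁ = _ ∷ l₁} {l₂} {_ ∷ l} (consˡ p) (g ∷ u) (y₀ ∷ y) h₁ h₂ = begin
  amplitude (g ∷ u) (y₀ ∷ y) h
    ≡⟨ amplitude-∷ g u y₀ y h ⟩
  (e false g* amplitude u y (λ x → h (false ∷ x))) g+ (e true g* amplitude u y (λ x → h (true ∷ x)))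
    ≡⟨ cong₂ (λ s t → (e false g* s) g+ (e true g* t)) (amplitude-interleave p u y (h₁′ false) h₂)
                                                        (amplitude-interleave p u y (h₁′ true) h₂) ⟩
  (e false g* (a false g* b)) g+ (e true g* (a true g* b))
    ≡⟨ g*-factorʳ (e false) (a false) (e true) (a true) b ⟩
  ((e false g* a false) g+ (e true g* a true)) g* b
    ≡⟨ cong (_g* b) (≡.sym (amplitude-∷ g (split₁ p u) y₀ (split₁ p y) h₁)) ⟩
  amplitude (g ∷ split₁ p u) (y₀ ∷ split₁ p y) h₁ g* b ∎
  where
  open ≡-Reasoning
  h : Vec Bool (suc (length l)) → Bool
  h x = h₁ (split₁ (consˡ p) x) xor h₂ (split₂ (consˡ p) x)
  e : Bool → GI
  e = entry g y₀
  h₁′ : Bool → Vec Bool (length l₁) → Bool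
  h₁′ c x = h₁ (c ∷ x)
  a : Bool → GI
  a c = amplitude (split₁ p u) (split₁ p y) (h₁′ c)
  b : GI
  b = amplitude (split₂ p u) (split₂ p y) h₂
amplitude-interleave {l₁ = l₁} {_ ∷ l₂} {_ ∷ l} (consʳ p) (g ∷ u) (y₀ ∷ y) h₁ h₂ = begin
  amplitude (g ∷ u) (y₀ ∷ y) h
    ≡⟨ amplitude-∷ g u y₀ y h ⟩
  (e false g* amplitude u y (λ x → h (false ∷ x))) g+ (e true g* amplitude u y (λ x → h (true ∷ x)))
    ≡⟨ cong₂ (λ s t → (e false g* s) g+ (e true g* t)) (amplitude-interleave p u y h₁ (h₂′ false))
                                                        (amplitude-interleave p u y h₁ (h₂′ true)) ⟩
  (e false g* (a g* b false)) g+ (e true g* (a g* b true))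
    ≡⟨ g*-factorˡ (e false) (b false) (e true) (b true) a ⟩
  a g* ((e false g* b false) g+ (e true g* b true))
    ≡⟨ cong (a g*_) (≡.sym (amplitude-∷ g (split₂ p u) y₀ (split₂ p y) h₂)) ⟩
  a g* amplitude (g ∷ split₂ p u) (y₀ ∷ split₂ p y) h₂ ∎
  where
  open ≡-Reasoning
  h : Vec Bool (suc (length l)) → Bool
  h x = h₁ (split₁ (consʳ p) x) xor h₂ (split₂ (consʳ p) x)
  e : Bool → GI
  e = entry g y₀
  h₂′ : Bool → Vec Bool (length l₂) → Bool
  h₂′ c x = h₂ (c ∷ x)
  a : GI
  a = amplitude (split₁ p u) (split₁ p y) h₁
  b : Bool → GI
  b c = amplitude (split₂ p u) (split₂ p y) (h₂′ c)

parity : List Bool → Bool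
parity = foldr _xor_ false

parity-++ : ∀ xs ys → parity (xs ++ ys) ≡ parity xs xor parity ys
parity-++ []       ys = refl
parity-++ (x ∷ xs) ys = ≡.trans (cong (x xor_) (parity-++ xs ys)) (≡.sym (Boolₚ.xor-assoc x (parity xs) (parity ys)))

parity-concat : ∀ xss → parity (concat xss) ≡ parity (map parity xss)
parity-concat []         = refl
parity-concat (xs ∷ xss) = ≡.trans (parity-++ xs (concat xss)) (cong (parity xs xor_) (parity-concat xss))

linForm : ∀ {m} → (Fin m → Bool) → Vec Bool m → Bool
linForm r []      = false
linForm r (c ∷ x) = (r zero ∧ c) xor linForm (λ b → r (suc b)) x

quadForm : ∀ {m} → (Fin m → Fin m → Bool) → Vec Bool m → Bool
quadForm A []      = false
quadForm A (c ∷ x) = (c ∧ linForm (λ b → A zero (suc b)) x) xor quadForm (λ a b → A (suc a) (suc b)) x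

upperTerm : ∀ {m} → (Fin m → Fin m → Bool) → Vec Bool m → Fin m → Fin m → Bool
upperTerm A x a b = (toℕ a <ᵇ toℕ b) ∧ A a b ∧ Vec.lookup x a ∧ Vec.lookup x b

parity-row : ∀ {m} (r : Fin m → Bool) c x →
  parity (tabulate (λ b → r b ∧ (c ∧ Vec.lookup x b))) ≡ c ∧ linForm r x
parity-row r c []       = ≡.sym (Boolₚ.∧-zeroʳ c)
parity-row r c (x₀ ∷ x) =
  ≡.trans (cong ((r zero ∧ (c ∧ x₀)) xor_) (parity-row (λ b → r (suc b)) c x)) (factor c x₀)
  where
  factor : ∀ c x₀ → (r zero ∧ (c ∧ x₀)) xor (c ∧ linForm (λ b → r (suc b)) x)
                  ≡ c ∧ ((r zero ∧ x₀) xor linForm (λ b → r (suc b)) x)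
  factor false x₀ = cong (_xor false) (Boolₚ.∧-zeroʳ (r zero))
  factor true  x₀ = refl

-- Row 0 of the upper triangle is x₀ times a linear form; the other rows are those of the tail.
parity-upperTerm : ∀ {m} (A : Fin m → Fin m → Bool) x →
  parity (tabulate (λ a → parity (tabulate (upperTerm A x a)))) ≡ quadForm A x
parity-upperTerm A []      = refl
parity-upperTerm A (c ∷ x) =
  cong₂ _xor_ (parity-row (λ b → A zero (suc b)) c x) (parity-upperTerm (λ a b → A (suc a) (suc b)) x)

pG-quadForm : ∀ {m} (G : Graph m) x → pG G x ≡ quadForm (adj G) x
pG-quadForm {m} G x = begin
  parity (concat (map row (allFin m)))                     ≡⟨ parity-concat (map row (allFin m)) ⟩
  parity (map parity (map row (allFin m)))                 ≡⟨ cong parity rows ⟩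
  parity (tabulate (λ a → parity (tabulate (term a))))     ≡⟨ parity-upperTerm (adj G) x ⟩
  quadForm (adj G) x                                       ∎
  where
  open ≡-Reasoning
  term : Fin m → Fin m → Bool
  term = upperTerm (adj G) x
  row : Fin m → List Bool
  row a = map (term a) (allFin m)
  rows : map parity (map row (allFin m)) ≡ tabulate (λ a → parity (tabulate (term a)))
  rows = ≡.trans (≡.sym (Listₚ.map-∘ (allFin m)))
    (≡.trans (Listₚ.map-tabulate id (parity ∘ row))
             (Listₚ.tabulate-cong (λ a → cong parity (Listₚ.map-tabulate id (term a)))))

pG-cong : ∀ {m} (G G′ : Graph m) → (∀ a b → adj G a b ≡ adj G′ a b) → ∀ x → pG G x ≡ pG G′ x
pG-cong {m} G G′ eq x = cong (parity ∘ concat)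
  (Listₚ.map-cong (λ a → Listₚ.map-cong (λ b → cong (entry-with a b) (eq a b)) (allFin m)) (allFin m))
  where
  entry-with : Fin m → Fin m → Bool → Bool
  entry-with a b e = (toℕ a <ᵇ toℕ b) ∧ e ∧ Vec.lookup x a ∧ Vec.lookup x b

NoEdges : ∀ {n} → Graph n → List (Fin n) → List (Fin n) → Set
NoEdges G l₁ l₂ = All (λ a → All (λ b → adj G a b ≡ false) l₂) l₁

linForm-interleave : ∀ {X : Set} {l₁ l₂ l : List X} (p : Interleaving l₁ l₂ l) (f : X → Bool) x →
  linForm (f ∘ lookup l) x ≡ linForm (f ∘ lookup l₁) (split₁ p x) xor linForm (f ∘ lookup l₂) (split₂ p x)
linForm-interleave []                    f []      = refl
linForm-interleave {l₁ = v ∷ l₁} (consˡ p) f (c ∷ x) =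
  ≡.trans (cong ((f v ∧ c) xor_) (linForm-interleave p f x))
          (≡.sym (Boolₚ.xor-assoc (f v ∧ c) (linForm (f ∘ lookup l₁) (split₁ p x)) _))
linForm-interleave {l₁ = l₁} {v ∷ l₂} (consʳ p) f (c ∷ x) =
  ≡.trans (cong ((f v ∧ c) xor_) (linForm-interleave p f x))
          (x∙yz≈y∙xz (f v ∧ c) (linForm (f ∘ lookup l₁) (split₁ p x)) _)

linForm-vanishing : ∀ {X : Set} (f : X → Bool) (l : List X) → All (λ w → f w ≡ false) l →
  ∀ x → linForm (f ∘ lookup l) x ≡ false
linForm-vanishing f []      []         []      = refl
linForm-vanishing f (w ∷ l) (fw ∷ fl) (c ∷ x) rewrite fw = linForm-vanishing f l fl x

module _ {n} (G : Graph n) where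

  quadForm-interleave : ∀ {l₁ l₂ l} (p : Interleaving l₁ l₂ l) → NoEdges G l₁ l₂ → ∀ x →
    quadForm (adj (induced G l)) x
      ≡ quadForm (adj (induced G l₁)) (split₁ p x) xor quadForm (adj (induced G l₂)) (split₂ p x)
  quadForm-interleave []                     []         []      = refl
  quadForm-interleave {v ∷ l₁} {l₂} {_ ∷ l} (consˡ p) (v≁l₂ ∷ ne) (c ∷ x) = begin
    (c ∧ linForm (adj G v ∘ lookup l) x) xor quadForm (adj (induced G l)) x
      ≡⟨ cong₂ (λ d q → (c ∧ d) xor q)
               (≡.trans (linForm-interleave p (adj G v) x)
                        (cong (d₁ xor_) (linForm-vanishing (adj G v) l₂ v≁l₂ (split₂ p x))))
               (quadForm-interleave p ne x) ⟩
    (c ∧ (d₁ xor false)) xor (q₁ xor q₂)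
      ≡⟨ cong (λ d → (c ∧ d) xor (q₁ xor q₂)) (Boolₚ.xor-identityʳ d₁) ⟩
    (c ∧ d₁) xor (q₁ xor q₂)
      ≡⟨ ≡.sym (Boolₚ.xor-assoc (c ∧ d₁) q₁ q₂) ⟩
    ((c ∧ d₁) xor q₁) xor q₂ ∎
    where
    open ≡-Reasoning
    d₁ q₁ q₂ : Bool
    d₁ = linForm (adj G v ∘ lookup l₁) (split₁ p x)
    q₁ = quadForm (adj (induced G l₁)) (split₁ p x)
    q₂ = quadForm (adj (induced G l₂)) (split₂ p x)
  quadForm-interleave {l₁} {v ∷ l₂} {_ ∷ l} (consʳ p) ne (c ∷ x) = begin
    (c ∧ linForm (adj G v ∘ lookup l) x) xor quadForm (adj (induced G l)) x
      ≡⟨ cong₂ (λ d q → (c ∧ d) xor q)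
               (≡.trans (linForm-interleave p (adj G v) x)
                        (cong (_xor d₂) (linForm-vanishing (adj G v) l₁ v≁l₁ (split₁ p x))))
               (quadForm-interleave p (All.map All.tail ne) x) ⟩
    (c ∧ d₂) xor (q₁ xor q₂)
      ≡⟨ x∙yz≈y∙xz (c ∧ d₂) q₁ q₂ ⟩
    q₁ xor ((c ∧ d₂) xor q₂) ∎
    where
    open ≡-Reasoning
    v≁l₁ : All (λ a → adj G v a ≡ false) l₁
    v≁l₁ = All.map (λ {a} a≁l₂ → ≡.trans (sym G v a) (All.head a≁l₂)) ne
    d₂ q₁ q₂ : Bool
    d₂ = linForm (adj G v ∘ lookup l₂) (split₂ p x)
    q₁ = quadForm (adj (induced G l₁)) (split₁ p x)
    q₂ = quadForm (adj (induced G l₂)) (split₂ p x)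

  pG-interleave : ∀ {l₁ l₂ l} (p : Interleaving l₁ l₂ l) → NoEdges G l₁ l₂ → ∀ x →
    pG (induced G l) x ≡ pG (induced G l₁) (split₁ p x) xor pG (induced G l₂) (split₂ p x)
  pG-interleave {l₁} {l₂} {l} p ne x = begin
    pG (induced G l) x
      ≡⟨ pG-quadForm (induced G l) x ⟩
    quadForm (adj (induced G l)) x
      ≡⟨ quadForm-interleave p ne x ⟩
    quadForm (adj (induced G l₁)) (split₁ p x) xor quadForm (adj (induced G l₂)) (split₂ p x)
      ≡⟨ ≡.sym (cong₂ _xor_ (pG-quadForm (induced G l₁) (split₁ p x))
                            (pG-quadForm (induced G l₂) (split₂ p x))) ⟩
    pG (induced G l₁) (split₁ p x) xor pG (induced G l₂) (split₂ p x) ∎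
    where open ≡-Reasoning

count : ∀ {A : Set} → (A → Bool) → List A → ℕ
count q []       = 0
count q (x ∷ xs) = if q x then suc (count q xs) else count q xs

length-filter-count : ∀ {A : Set} (q : A → Bool) xs → length (filter (λ x → q x Bool.≟ true) xs) ≡ count q xs
length-filter-count q []       = refl
length-filter-count q (x ∷ xs) with q x
... | true  = cong suc (length-filter-count q xs)
... | false = length-filter-count q xs

count-++ : ∀ {A : Set} (q : A → Bool) xs ys → count q (xs ++ ys) ≡ count q xs + count q ys
count-++ q []       ys = refl
count-++ q (x ∷ xs) ys with q x
... | true  = cong suc (count-++ q xs ys)
... | false = count-++ q xs ys

count-concat : ∀ {A : Set} (q : A → Bool) xss → count q (concat xss) ≡ sum (map (count q) xss)
count-concat q []         = refl
count-concat q (xs ∷ xss) = ≡.trans (count-++ q xs (concat xss)) (cong (λ k → count q xs + k) (count-concat q xss))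

count-map : ∀ {A B : Set} (q : B → Bool) (f : A → B) xs → count q (map f xs) ≡ count (q ∘ f) xs
count-map q f []       = refl
count-map q f (x ∷ xs) with q (f x)
... | true  = cong suc (count-map q f xs)
... | false = count-map q f xs

count-cong : ∀ {A : Set} {q q′ : A → Bool} → (∀ x → q x ≡ q′ x) → ∀ xs → count q xs ≡ count q′ xs
count-cong eq []       = refl
count-cong {q′ = q′} eq (x ∷ xs) rewrite eq x = cong (λ k → if q′ x then suc k else k) (count-cong eq xs)

count-allVecs-suc : ∀ {A : Set} (L : List A) {m} (q : Vec A (suc m) → Bool) →
  count q (allVecs L (suc m)) ≡ sum (map (λ a → count (λ w → q (a ∷ w)) (allVecs L m)) L)
count-allVecs-suc L {m} q = begin
  count q (concat (map (λ a → map (a ∷_) (allVecs L m)) L))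
    ≡⟨ count-concat q (map (λ a → map (a ∷_) (allVecs L m)) L) ⟩
  sum (map (count q) (map (λ a → map (a ∷_) (allVecs L m)) L))
    ≡⟨ cong sum (≡.trans (≡.sym (Listₚ.map-∘ L))
                         (Listₚ.map-cong (λ a → count-map q (a ∷_) (allVecs L m)) L)) ⟩
  sum (map (λ a → count (λ w → q (a ∷ w)) (allVecs L m)) L) ∎
  where open ≡-Reasoning

sum-map-*-mono : ∀ {A : Set} (xs : List A) {f g : A → ℕ} c →
  (∀ a → f a * c ≤ g a) → sum (map f xs) * c ≤ sum (map g xs)
sum-map-*-mono []       c le = z≤n
sum-map-*-mono (x ∷ xs) {f} {g} c le = begin
  (f x + sum (map f xs)) * c        ≡⟨ ℕₚ.*-distribʳ-+ c (f x) (sum (map f xs)) ⟩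
  f x * c + sum (map f xs) * c      ≤⟨ ℕₚ.+-mono-≤ (le x) (sum-map-*-mono xs c le) ⟩
  g x + sum (map g xs)              ∎
  where open ℕₚ.≤-Reasoning

-- Holds because merge p is injective.
count-merge : ∀ {X A : Set} (L : List A) {l₁ l₂ l : List X} (p : Interleaving l₁ l₂ l) q₁ q₂ q →
  (∀ u₁ u₂ → q₁ u₁ ≡ true → q₂ u₂ ≡ true → q (merge p u₁ u₂) ≡ true) →
  count q₁ (allVecs L (length l₁)) * count q₂ (allVecs L (length l₂)) ≤ count q (allVecs L (length l))
count-merge L [] q₁ q₂ q closed with q₁ [] in e₁ | q₂ [] in e₂
... | false | _     = z≤n
... | true  | false = z≤n
... | true  | true  rewrite closed [] [] e₁ e₂ = ℕₚ.≤-refl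
count-merge L {_ ∷ l₁} {l₂} (consˡ p) q₁ q₂ q closed = begin
  count q₁ (allVecs L (suc (length l₁))) * c₂
    ≡⟨ cong (_* c₂) (count-allVecs-suc L q₁) ⟩
  sum (map (λ a → count (λ w → q₁ (a ∷ w)) (allVecs L (length l₁))) L) * c₂
    ≤⟨ sum-map-*-mono L c₂ (λ a → count-merge L p (λ w → q₁ (a ∷ w)) q₂ (λ w → q (a ∷ w))
                                                (λ u₁ u₂ → closed (a ∷ u₁) u₂)) ⟩
  sum (map (λ a → count (λ w → q (a ∷ w)) (allVecs L _)) L)
    ≡⟨ ≡.sym (count-allVecs-suc L q) ⟩
  count q (allVecs L _) ∎
  where
  open ℕₚ.≤-Reasoning
  c₂ : ℕ
  c₂ = count q₂ (allVecs L (length l₂))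
count-merge L {l₁} {_ ∷ l₂} (consʳ p) q₁ q₂ q closed = begin
  c₁ * count q₂ (allVecs L (suc (length l₂)))
    ≡⟨ ℕₚ.*-comm c₁ _ ⟩
  count q₂ (allVecs L (suc (length l₂))) * c₁
    ≡⟨ cong (_* c₁) (count-allVecs-suc L q₂) ⟩
  sum (map (λ a → count (λ w → q₂ (a ∷ w)) (allVecs L (length l₂))) L) * c₁
    ≤⟨ sum-map-*-mono L c₁ (λ a → ℕₚ.≤-trans (ℕₚ.≤-reflexive (ℕₚ.*-comm _ c₁))
         (count-merge L p q₁ (λ w → q₂ (a ∷ w)) (λ w → q (a ∷ w)) (λ u₁ u₂ → closed u₁ (a ∷ u₂)))) ⟩
  sum (map (λ a → count (λ w → q (a ∷ w)) (allVecs L _)) L)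
    ≡⟨ ≡.sym (count-allVecs-suc L q) ⟩
  count q (allVecs L _) ∎
  where
  open ℕₚ.≤-Reasoning
  c₁ : ℕ
  c₁ = count q₁ (allVecs L (length l₁))

allB-sound : ∀ {A : Set} (f : A → Bool) xs → allB f xs ≡ true → All (λ x → f x ≡ true) xs
allB-sound f []       _ = []
allB-sound f (x ∷ xs) e with f x in fx
allB-sound f (x ∷ xs) e  | true  = fx ∷ allB-sound f xs e
allB-sound f (x ∷ xs) () | false

allB-complete : ∀ {A : Set} (f : A → Bool) xs → (∀ x → f x ≡ true) → allB f xs ≡ true
allB-complete f []       all-true = refl
allB-complete f (x ∷ xs) all-true rewrite all-true x = allB-complete f xs all-true

allB-cong : ∀ {A : Set} {f f′ : A → Bool} → (∀ x → f x ≡ f′ x) → ∀ xs → allB f xs ≡ allB f′ xs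
allB-cong eq []       = refl
allB-cong eq (x ∷ xs) = cong₂ _∧_ (eq x) (allB-cong eq xs)

∈-allVecs : ∀ {A : Set} {L : List A} → (∀ a → a ∈ L) → ∀ {m} (w : Vec A m) → w ∈ allVecs L m
∈-allVecs L-complete []      = here refl
∈-allVecs {L = L} L-complete {suc m} (a ∷ w) =
  ∈-concatMap⁺ (λ b → map (b ∷_) (allVecs L m))
    (Any.map (λ { refl → ∈-map⁺ (a ∷_) (∈-allVecs L-complete w) }) (L-complete a))

∈-allBits : ∀ {m} (y : Vec Bool m) → y ∈ allBits m
∈-allBits = ∈-allVecs λ { false → here refl ; true → there (here refl) }

Flat : ∀ {m} → Graph m → Vec Gate m → Set
Flat G u = ∀ y → normSq (scaledOut G u y) ≡ + (2 ^ scaleExp u)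

flatB-sound : ∀ {m} (G : Graph m) u → flatB G u ≡ true → Flat G u
flatB-sound {m} G u e y =
  toWitness (Equivalence.from Boolₚ.T-≡ (All.lookup (allB-sound _ (allBits m) e) (∈-allBits y)))

flatB-complete : ∀ {m} (G : Graph m) u → Flat G u → flatB G u ≡ true
flatB-complete {m} G u flat = allB-complete _ (allBits m) (λ y → Equivalence.to Boolₚ.T-≡ (fromWitness (flat y)))

K-IHN-count : ∀ {m} (G : Graph m) → K-IHN G ≡ count (flatB G) (allTransforms m)
K-IHN-count {m} G = length-filter-count (flatB G) (allTransforms m)

K-IHN-cong : ∀ {m} (G G′ : Graph m) → (∀ x → pG G x ≡ pG G′ x) → K-IHN G ≡ K-IHN G′
K-IHN-cong {m} G G′ eq = begin
  K-IHN G                             ≡⟨ K-IHN-count G ⟩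
  count (flatB G) (allTransforms m)   ≡⟨ count-cong flatB-eq (allTransforms m) ⟩
  count (flatB G′) (allTransforms m)  ≡⟨ ≡.sym (K-IHN-count G′) ⟩
  K-IHN G′                            ∎
  where
  open ≡-Reasoning
  flatB-eq : ∀ u → flatB G u ≡ flatB G′ u
  flatB-eq u = allB-cong (λ y → cong (λ z → ⌊ normSq z ℤ.≟ + (2 ^ scaleExp u) ⌋) (amplitude-cong u y eq))
                         (allBits m)

K-IHN-cast : ∀ {m n} (e : m ≡ n) (G′ : Graph m) (G : Graph n) →
  (∀ a b → adj G′ a b ≡ adj G (cast e a) (cast e b)) → K-IHN G′ ≡ K-IHN G
K-IHN-cast refl G′ G eq = K-IHN-cong G′ G (pG-cong G′ G (λ a b →
  ≡.trans (eq a b) (cong₂ (adj G) (cast-is-id refl a) (cast-is-id refl b))))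

K-IHN-induced-allFin : ∀ {n} (G : Graph n) → K-IHN (induced G (allFin n)) ≡ K-IHN G
K-IHN-induced-allFin {n} G =
  K-IHN-cast e (induced G (allFin n)) G (λ a b → cong₂ (adj G) (lookup-allFin a) (lookup-allFin b))
  where
  e : length (allFin n) ≡ n
  e = Listₚ.length-tabulate id
  lookup-allFin : ∀ a → lookup (allFin n) a ≡ cast e a
  lookup-allFin a = ≡.trans (cong (lookup (allFin n)) (≡.sym (cast-involutive (≡.sym e) e a)))
                            (Listₚ.lookup-tabulate id (cast e a))

module _ {n} (G : Graph n) {l₁ l₂ l : List (Fin n)} (p : Interleaving l₁ l₂ l) (ne : NoEdges G l₁ l₂) where

  scaledOut-merge : ∀ u₁ u₂ y → scaledOut (induced G l) (merge p u₁ u₂) y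
    ≡ scaledOut (induced G l₁) u₁ (split₁ p y) g* scaledOut (induced G l₂) u₂ (split₂ p y)
  scaledOut-merge u₁ u₂ y = begin
    amplitude u y (pG (induced G l))
      ≡⟨ amplitude-cong u y (pG-interleave G p ne) ⟩
    amplitude u y (λ x → pG (induced G l₁) (split₁ p x) xor pG (induced G l₂) (split₂ p x))
      ≡⟨ amplitude-interleave p u y (pG (induced G l₁)) (pG (induced G l₂)) ⟩
    amplitude (split₁ p u) (split₁ p y) (pG (induced G l₁))
      g* amplitude (split₂ p u) (split₂ p y) (pG (induced G l₂))
      ≡⟨ cong₂ (λ v₁ v₂ → amplitude v₁ (split₁ p y) (pG (induced G l₁))
                           g* amplitude v₂ (split₂ p y) (pG (induced G l₂)))
               (split₁-merge p u₁ u₂) (split₂-merge p u₁ u₂) ⟩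
    amplitude u₁ (split₁ p y) (pG (induced G l₁)) g* amplitude u₂ (split₂ p y) (pG (induced G l₂)) ∎
    where
    open ≡-Reasoning
    u : Vec Gate (length l)
    u = merge p u₁ u₂

  Flat-merge : ∀ {u₁ u₂} → Flat (induced G l₁) u₁ → Flat (induced G l₂) u₂ →
               Flat (induced G l) (merge p u₁ u₂)
  Flat-merge {u₁} {u₂} flat₁ flat₂ y = begin
    normSq (scaledOut (induced G l) (merge p u₁ u₂) y)
      ≡⟨ cong normSq (scaledOut-merge u₁ u₂ y) ⟩
    normSq (scaledOut (induced G l₁) u₁ (split₁ p y) g* scaledOut (induced G l₂) u₂ (split₂ p y))
      ≡⟨ normSq-g* (scaledOut (induced G l₁) u₁ (split₁ p y)) (scaledOut (induced G l₂) u₂ (split₂ p y)) ⟩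
    normSq (scaledOut (induced G l₁) u₁ (split₁ p y)) ℤ.* normSq (scaledOut (induced G l₂) u₂ (split₂ p y))
      ≡⟨ cong₂ ℤ._*_ (flat₁ (split₁ p y)) (flat₂ (split₂ p y)) ⟩
    + (2 ^ k₁) ℤ.* + (2 ^ k₂)
      ≡⟨ ≡.sym (ℤₚ.pos-* (2 ^ k₁) (2 ^ k₂)) ⟩
    + (2 ^ k₁ * 2 ^ k₂)
      ≡⟨ cong +_ (≡.sym (ℕₚ.^-distribˡ-+-* 2 k₁ k₂)) ⟩
    + (2 ^ (k₁ + k₂))
      ≡⟨ cong (λ k → + (2 ^ k)) (≡.sym (scaleExp-merge p u₁ u₂)) ⟩
    + (2 ^ scaleExp (merge p u₁ u₂)) ∎
    where
    open ≡-Reasoning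
    k₁ k₂ : ℕ
    k₁ = scaleExp u₁
    k₂ = scaleExp u₂

  K-IHN-interleave : K-IHN (induced G l₁) * K-IHN (induced G l₂) ≤ K-IHN (induced G l)
  K-IHN-interleave = subst₂ _≤_
    (≡.sym (cong₂ _*_ (K-IHN-count (induced G l₁)) (K-IHN-count (induced G l₂))))
    (≡.sym (K-IHN-count (induced G l)))
    (count-merge (I ∷ H ∷ N ∷ []) p (flatB (induced G l₁)) (flatB (induced G l₂)) (flatB (induced G l))
      (λ u₁ u₂ e₁ e₂ → flatB-complete (induced G l) (merge p u₁ u₂)
        (Flat-merge (flatB-sound (induced G l₁) u₁ e₁) (flatB-sound (induced G l₂) u₂ e₂))))

filter-interleave : ∀ {A : Set} {P Q R : A → Set} (P? : Decidable P) (Q? : Decidable Q) (R? : Decidable R) →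
  (∀ {x} → R x ⇔ (P x ⊎ Q x)) → (∀ {x} → P x → ¬ Q x) →
  ∀ xs → Interleaving (filter P? xs) (filter Q? xs) (filter R? xs)
filter-interleave P? Q? R? R⇔P⊎Q disjoint [] = []
filter-interleave P? Q? R? R⇔P⊎Q disjoint (x ∷ xs) with P? x | Q? x | R? x
... | yes p | yes q | _     = ⊥-elim (disjoint p q)
... | yes p | no _  | yes _ = consˡ (filter-interleave P? Q? R? R⇔P⊎Q disjoint xs)
... | yes p | no _  | no ¬r = ⊥-elim (¬r (Equivalence.from R⇔P⊎Q (inj₁ p)))
... | no _  | yes q | yes _ = consʳ (filter-interleave P? Q? R? R⇔P⊎Q disjoint xs)
... | no _  | yes q | no ¬r = ⊥-elim (¬r (Equivalence.from R⇔P⊎Q (inj₂ q)))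
... | no ¬p | no ¬q | yes r = ⊥-elim ([ ¬p , ¬q ] (Equivalence.to R⇔P⊎Q r))
... | no _  | no _  | no _  = filter-interleave P? Q? R? R⇔P⊎Q disjoint xs

module _ {n t} (comp : Fin n → Fin t) where

  open import Data.List.Membership.DecPropositional (_≟_ {t}) using (_∈?_)

  unionMembers : List (Fin t) → List (Fin n)
  unionMembers ks = filter (λ v → comp v ∈? ks) (allFin n)

  unionMembers-[] : unionMembers [] ≡ []
  unionMembers-[] = Listₚ.filter-none (λ v → comp v ∈? []) (All.tabulate {xs = allFin n} (λ _ ()))

  unionMembers-allFin : unionMembers (allFin t) ≡ allFin n
  unionMembers-allFin =
    Listₚ.filter-all (λ v → comp v ∈? allFin t) (All.tabulate {xs = allFin n} (λ {v} _ → ∈-allFin (comp v)))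

  members-interleave : ∀ {i ks} → i ∉ ks → Interleaving (members comp i) (unionMembers ks) (unionMembers (i ∷ ks))
  members-interleave {i} {ks} i∉ks =
    filter-interleave (λ v → comp v ≟ i) (λ v → comp v ∈? ks) (λ v → comp v ∈? (i ∷ ks))
      (mk⇔ (λ { (here e) → inj₁ e ; (there m) → inj₂ m }) [ here , there ])
      (λ e m → i∉ks (subst (_∈ ks) e m))
      (allFin n)

module _ {n t} (G : Graph n) (comp : Fin n → Fin t)
         (adjacent⇒same : ∀ {u v} → adj G u v ≡ true → comp u ≡ comp v) where

  open import Data.List.Membership.DecPropositional (_≟_ {t}) using (_∈?_)

  members-noEdges : ∀ {i ks} → i ∉ ks → NoEdges G (members comp i) (unionMembers comp ks)
  members-noEdges {i} {ks} i∉ks =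
    All.map (λ ca → All.map (no-edge ca) (all-filter (λ v → comp v ∈? ks) (allFin n)))
            (all-filter (λ v → comp v ≟ i) (allFin n))
    where
    no-edge : ∀ {a b} → comp a ≡ i → comp b ∈ ks → adj G a b ≡ false
    no-edge {a} {b} ca cb with adj G a b in e
    ... | false = refl
    ... | true  = ⊥-elim (i∉ks (subst (_∈ ks) (≡.trans (≡.sym (adjacent⇒same e)) ca) cb))

  product-K-IHN-≤ : ∀ {ks} → Unique ks →
    product (map (λ i → K-IHN (component G comp i)) ks) ≤ K-IHN (induced G (unionMembers comp ks))
  product-K-IHN-≤ {[]}     []                =
    ℕₚ.≤-reflexive (cong (K-IHN ∘ induced G) (≡.sym (unionMembers-[] comp)))
  product-K-IHN-≤ {i ∷ ks} (i≢ks ∷ distinct) = ℕₚ.≤-trans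
    (ℕₚ.*-monoʳ-≤ (K-IHN (component G comp i)) (product-K-IHN-≤ distinct))
    (K-IHN-interleave G (members-interleave comp i∉ks) (members-noEdges i∉ks))
    where
    i∉ks : i ∉ ks
    i∉ks = All¬⇒¬Any i≢ks

lemma6 : ∀ {n : ℕ} (G : Graph n) (t : ℕ) (comp : Fin n → Fin t)
           → (∀ i → ∃ λ v → comp v ≡ i)
           → (∀ u v → (comp u ≡ comp v) ⇔ Reachable G u v)
           → K-IHN G ≥ product (map (λ i → K-IHN (component G comp i)) (allFin t))
lemma6 {n} G t comp _ same⇔reachable = begin
  product (map (λ i → K-IHN (component G comp i)) (allFin t))
    ≤⟨ product-K-IHN-≤ G comp adjacent⇒same (allFin⁺ t) ⟩
  K-IHN (induced G (unionMembers comp (allFin t)))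
    ≡⟨ cong (K-IHN ∘ induced G) (unionMembers-allFin comp) ⟩
  K-IHN (induced G (allFin n))
    ≡⟨ K-IHN-induced-allFin G ⟩
  K-IHN G ∎
  where
  open ℕₚ.≤-Reasoning
  adjacent⇒same : ∀ {u v} → adj G u v ≡ true → comp u ≡ comp v
  adjacent⇒same e = Equivalence.from (same⇔reachable _ _) (step e here)
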